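{- Let $\mathbf{P}$ be a finite poset with at least two elements, let $w=\mathrm{width}(\mathbf{P})$ and let $k\geq 0$. Then $|P_k|\leq 2w^{(3w)^k}$.
   Context: $\mathrm{width}(\mathbf{P})$ is the maximum size of an antichain in $\mathbf{P}$. The sets $P_i$ are defined as follows: $L_0=\min(\mathbf{P})$ (minimal elements), $U_0=\max(\mathbf{P})\setminus L_0$, $P_0=L_0\cup U_0$. For $i\geq1$, call $R\subseteq P_{i-1}$ admissible if $R\cap L_{i-1}$ is downward closed within $L_{i-1}$ (if $l\in R\cap L_{i-1}$, $l'\in L_{i-1}$, $l'\leq l$ then $l'\in R$) and $R\cap U_{i-1}$ is upward closed within $U_{i-1}$; set $P_{i-1,R}=\{p\in P:\ \forall l\in L_{i-1}\,(l\leq p\iff l\in R),\ \forall u\in U_{i-1}\,(p\leq u\iff u\in R)\}$; then $L_i=L_{i-1}\cup\bigcup_R\min(P_{i-1,R})$ and $U_i=\big(U_{i-1}\cup\bigcup_R\max(P_{i-1,R})\big)\setminus L_i$, unions over admissible $R$, where $\min(S)$, $\max(S)$ denote the minimal/maximal elements of the subposet induced by $S$; $P_i=L_i\cup U_i$. The bound reads $2\cdot w^{((3w)^k)}$. -}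

module Defs where

open import Data.Nat using (ℕ; zero; suc; _≤_)
open import Data.Fin using (Fin)
open import Data.Bool using (Bool; T)
open import Data.List using (List; length)
open import Data.List.Relation.Unary.All using (All)
open import Data.List.Relation.Unary.AllPairs using (AllPairs)
open import Data.List.Relation.Unary.Unique.Propositional using (Unique)
open import Data.Product using (Σ; _×_; ∃)
open import Data.Sum using (_⊎_)
open import Data.Unit using (⊤)
open import Relation.Nullary using (¬_)
open import Relation.Binary.PropositionalEquality using (_≡_)

-- A finite poset is represented on the carrier Fin n by a relation _⊑_
-- (the partial-order axioms are hypotheses of the theorem).
-- Subsets of the poset are predicates Fin n → Set.

module Construction {n : ℕ} (_⊑_ : Fin n → Fin n → Set) where

  Pred : Set₁
  Pred = Fin n → Set

  CardLE : Pred → ℕ → Set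
  CardLE S b = (xs : List (Fin n)) → Unique xs → All S xs → length xs ≤ b

  Incomparable : Fin n → Fin n → Set
  Incomparable x y = ¬ (x ⊑ y) × ¬ (y ⊑ x)

  IsAntichain : List (Fin n) → Set
  IsAntichain xs = Unique xs × AllPairs Incomparable xs

  IsWidth : ℕ → Set
  IsWidth w = (Σ (List (Fin n)) λ xs → IsAntichain xs × length xs ≡ w)
            × ((xs : List (Fin n)) → IsAntichain xs → length xs ≤ w)

  Min : Pred → Pred
  Min S x = S x × ((y : Fin n) → S y → y ⊑ x → y ≡ x)

  Max : Pred → Pred
  Max S x = S x × ((y : Fin n) → S y → x ⊑ y → y ≡ x)

  Whole : Pred
  Whole _ = ⊤

  L₀ : Pred
  L₀ = Min Whole

  U₀ : Pred
  U₀ x = Max Whole x × ¬ L₀ x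

  -- subsets R ⊆ P_{i-1} are given by characteristic functions Fin n → Bool
  module Step (L U : Pred) where

    Admissible : (Fin n → Bool) → Set
    Admissible R =
        ((x : Fin n) → T (R x) → L x ⊎ U x)
      × ((l l' : Fin n) → L l → T (R l) → L l' → l' ⊑ l → T (R l'))
      × ((u u' : Fin n) → U u → T (R u) → U u' → u ⊑ u' → T (R u'))

    Cell : (Fin n → Bool) → Pred
    Cell R p =
        ((l : Fin n) → L l → ((l ⊑ p → T (R l)) × (T (R l) → l ⊑ p)))
      × ((u : Fin n) → U u → ((p ⊑ u → T (R u)) × (T (R u) → p ⊑ u)))

    L' : Pred
    L' x = L x ⊎ Σ (Fin n → Bool) λ R → Admissible R × Min (Cell R) x

    U' : Pred
    U' x = (U x ⊎ Σ (Fin n → Bool) λ R → Admissible R × Max (Cell R) x) × ¬ L' x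

  LU : ℕ → Pred × Pred
  LU zero = L₀ Data.Product., U₀
  LU (suc i) = let open Step (Data.Product.proj₁ (LU i)) (Data.Product.proj₂ (LU i))
               in L' Data.Product., U'

  Lₖ Uₖ Pₖ : ℕ → Pred
  Lₖ i = Data.Product.proj₁ (LU i)
  Uₖ i = Data.Product.proj₂ (LU i)
  Pₖ i x = Lₖ i x ⊎ Uₖ i x

-- Induction on k.  |P_0| ≤ 2w because L_0 and U_0 consist of minimal resp.
-- maximal elements, i.e. lie in antichains.  For the step from (L , U) = (L_i , U_i)
-- call the profile of y the set of elements of L below y together with the
-- elements of U above y.  Membership in a cell P_{i,R} depends only on the
-- profile, so comparable new minimal (maximal) elements with equal profiles
-- coincide: each profile class of new extremal elements is an antichain.
-- A profile is determined by its maximal elements in L and minimal elements in U,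
-- i.e. by a Boolean vector of length s = |P_i| and weight ≤ 2w (two antichains).
-- Counting by fibres gives |P_{i+1}| ≤ s + 2w·#codes with #codes ≤ 2^s and
-- #codes ≤ (s+1)^(2w); elementary arithmetic then yields the bound for w ≥ 2.
-- For w = 1 the poset is a chain, every element of L_k is least and every element
-- of U_k greatest, so |P_k| ≤ 2.  Width 0 is impossible for a nonempty poset.
-- Neither ⊑ nor the sets P_k are decidable a priori, but cardinality bounds are
-- decidable statements, so the proof may reason classically (double negation).

module Submission where

open import Defs
open import Level using (0ℓ)
open import Function using (_∘_; flip)
open import Data.Nat using (ℕ; zero; suc; _≤_; _≤′_; ≤′-refl; ≤′-step; _+_; _*_; _^_; z≤n; s≤s; _≤?_; NonZero; >-nonZero)
open import Data.Nat.Properties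
open import Data.Nat.Tactic.RingSolver using (solve-∀)
open import Data.Bool using (Bool; true; false; T; _∨_)
open import Data.Fin using (Fin; zero; suc) renaming (_≟_ to _≟ᶠ_)
open import Data.Fin.Induction using (po-wellFounded)
open import Data.Unit using (tt)
import Data.Bool as Bool
open import Data.List using (List; []; _∷_; length; map; filter; _++_; allFin)
open import Data.List.Properties using (length-map; length-++; ∷-injective; ≡-dec)
open import Data.List.Relation.Unary.All using (All; []; _∷_)
import Data.List.Relation.Unary.All as All
import Data.List.Relation.Unary.All.Properties as All
open import Data.List.Relation.Unary.Any using (here; there)
open import Data.List.Relation.Unary.Unique.Propositional using (Unique)
open import Data.List.Relation.Unary.AllPairs using (AllPairs; []; _∷_)
import Data.List.Relation.Unary.Unique.Propositional.Properties as Unique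
open import Data.List.Membership.Propositional using (_∈_)
open import Data.List.Membership.Propositional.Properties using (∈-map⁺; ∈-++⁺ˡ; ∈-++⁺ʳ; ∈-filter⁺; ∈-allFin)
open import Data.Product using (Σ; ∃; _×_; _,_; proj₁; proj₂; swap)
open import Data.Sum using (_⊎_; inj₁; inj₂)
open import Data.Empty using (⊥; ⊥-elim)
open import Relation.Nullary using (¬_; Dec; yes; no; does)
open import Relation.Nullary.Decidable using (decidable-stable; ¬¬-excluded-middle)
open import Relation.Nullary.Negation using (¬¬-Monad)
open import Effect.Monad using (RawMonad)
open import Relation.Unary using (Pred; Decidable; _∩_; _∪_; ∁; _⊆_)
open import Relation.Unary.Properties using (∁?)
open import Relation.Binary.Definitions using (DecidableEquality)
open import Relation.Binary.Structures using (IsPartialOrder)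
import Relation.Binary.Construct.Flip.EqAndOrd as Flip
open import Induction.WellFounded using (Acc; acc)
open import Relation.Binary.PropositionalEquality using (_≡_; refl; sym; trans; cong; cong₂; subst; module ≡-Reasoning)

open RawMonad (¬¬-Monad {0ℓ}) using (_>>=_; pure)

¬¬-shift : ∀ {n} {B : Fin n → Set} → (∀ x → ¬ ¬ B x) → ¬ ¬ (∀ x → B x)
¬¬-shift {zero} h = pure (λ ())
¬¬-shift {suc n} h = do
  b₀ ← h zero
  bs ← ¬¬-shift (h ∘ suc)
  pure (λ { zero → b₀ ; (suc x) → bs x })

¬¬-decidable : ∀ {n} (B : Fin n → Set) → ¬ ¬ (∀ x → Dec (B x))
¬¬-decidable B = ¬¬-shift (λ x → ¬¬-excluded-middle)

¬¬-decidable₂ : ∀ {n} (B : Fin n → Fin n → Set) → ¬ ¬ (∀ x y → Dec (B x y))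
¬¬-decidable₂ B = ¬¬-shift (λ x → ¬¬-decidable (B x))

-- Cardinality bounds.  `AtMost S b`: every duplicate-free list of elements of S
-- has length at most b (on Fin n this is exactly Construction.CardLE).

AtMost : {A : Set} → Pred A 0ℓ → ℕ → Set
AtMost {A} S b = (xs : List A) → Unique xs → All S xs → length xs ≤ b

module _ {A : Set} where

  -- A cardinality bound is a decidable statement, hence may be proved classically.
  atMost-stable : {S : Pred A 0ℓ} {b : ℕ} → ¬ ¬ AtMost S b → AtMost S b
  atMost-stable ¬¬bound xs u s =
    decidable-stable (length xs ≤? _) (λ ¬h → ¬¬bound (λ bound → ¬h (bound xs u s)))

  atMost-⊆ : {S T : Pred A 0ℓ} {b : ℕ} → S ⊆ T → AtMost T b → AtMost S b
  atMost-⊆ S⊆T bound xs u s = bound xs u (All.map S⊆T s)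

  atMost-weaken : {S : Pred A 0ℓ} {a b : ℕ} → a ≤ b → AtMost S a → AtMost S b
  atMost-weaken a≤b bound xs u s = ≤-trans (bound xs u s) a≤b

  length-filter-split : {D : Pred A 0ℓ} (D? : Decidable D) (xs : List A)
                      → length xs ≡ length (filter D? xs) + length (filter (∁? D?) xs)
  length-filter-split D? [] = refl
  length-filter-split D? (x ∷ xs) with D? x
  ... | yes _ = cong suc (length-filter-split D? xs)
  ... | no _ = trans (cong suc (length-filter-split D? xs)) (sym (+-suc _ _))

  atMost-split : {S D : Pred A 0ℓ} {a b : ℕ} (D? : Decidable D)
               → AtMost (S ∩ D) a → AtMost (S ∩ ∁ D) b → AtMost S (a + b)
  atMost-split D? boundD bound∁D xs u s =
    subst (_≤ _) (sym (length-filter-split D? xs))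
      (+-mono-≤ (boundD (filter D? xs) (Unique.filter⁺ D? u)
                        (All.zip (All.filter⁺ D? s , All.all-filter D? xs)))
                (bound∁D (filter (∁? D?) xs) (Unique.filter⁺ (∁? D?) u)
                         (All.zip (All.filter⁺ (∁? D?) s , All.all-filter (∁? D?) xs))))

  atMost-∪ : {S T : Pred A 0ℓ} {a b : ℕ} → Decidable S
           → AtMost S a → AtMost T b → AtMost (S ∪ T) (a + b)
  atMost-∪ {S} {T} S? boundS boundT =
    atMost-split S? (atMost-⊆ proj₂ boundS) (atMost-⊆ onlyT boundT)
    where onlyT : (S ∪ T) ∩ ∁ S ⊆ T
          onlyT (inj₁ s , ¬s) = ⊥-elim (¬s s)
          onlyT (inj₂ t , _) = t

  atMost-fibres : {C : Set} {S : Pred A 0ℓ} {b : ℕ} → DecidableEquality C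
                → (f : A → C) (cs : List C) → (∀ {x} → S x → f x ∈ cs)
                → (∀ c → AtMost (λ x → S x × f x ≡ c) b) → AtMost S (length cs * b)
  atMost-fibres {C} {S} {b} _≟_ f cs f∈cs fibre = atMost-⊆ (λ s → s , f∈cs s) (fibres cs)
    where
      fibres : (cs : List C) → AtMost (λ x → S x × f x ∈ cs) (length cs * b)
      fibres [] xs u s with xs | s
      ... | [] | [] = z≤n
      ... | _ ∷ _ | (_ , ()) ∷ _
      fibres (c ∷ cs) = atMost-split (λ x → f x ≟ c)
        (atMost-⊆ (λ ((s , _) , e) → s , e) (fibre c))
        (atMost-⊆ rest (fibres cs))
        where rest : (λ x → S x × f x ∈ c ∷ cs) ∩ ∁ (λ x → f x ≡ c) ⊆ (λ x → S x × f x ∈ cs)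
              rest ((s , here e) , ¬e) = ⊥-elim (¬e e)
              rest ((s , there m) , _) = s , m

-- A subset of a list ps is coded by a Boolean
-- vector of length |ps|; subsets of size ≤ k give vectors of weight ≤ k, of which
-- there are at most 2^m and at most (m+1)^k.

weight : List Bool → ℕ
weight [] = 0
weight (true ∷ v) = suc (weight v)
weight (false ∷ v) = weight v

lightVectors : ℕ → ℕ → List (List Bool)
lightVectors zero k = [] ∷ []
lightVectors (suc m) zero = map (false ∷_) (lightVectors m zero)
lightVectors (suc m) (suc k) = map (false ∷_) (lightVectors m (suc k)) ++ map (true ∷_) (lightVectors m k)

lightVectors-complete : ∀ v k → weight v ≤ k → v ∈ lightVectors (length v) k
lightVectors-complete [] k _ = here refl
lightVectors-complete (false ∷ v) zero h = ∈-map⁺ (false ∷_) (lightVectors-complete v zero h)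
lightVectors-complete (false ∷ v) (suc k) h =
  ∈-++⁺ˡ (∈-map⁺ (false ∷_) (lightVectors-complete v (suc k) h))
lightVectors-complete (true ∷ v) (suc k) (s≤s h) =
  ∈-++⁺ʳ _ (∈-map⁺ (true ∷_) (lightVectors-complete v k h))

#light : ℕ → ℕ → ℕ
#light m k = length (lightVectors m k)

#light-zero : ∀ m → #light (suc m) zero ≡ #light m zero
#light-zero m = length-map (false ∷_) (lightVectors m zero)

#light-suc : ∀ m k → #light (suc m) (suc k) ≡ #light m (suc k) + #light m k
#light-suc m k = begin
  length (map (false ∷_) (lightVectors m (suc k)) ++ map (true ∷_) (lightVectors m k))
    ≡⟨ length-++ (map (false ∷_) (lightVectors m (suc k))) ⟩
  length (map (false ∷_) (lightVectors m (suc k))) + length (map (true ∷_) (lightVectors m k))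
    ≡⟨ cong₂ _+_ (length-map _ (lightVectors m (suc k))) (length-map _ (lightVectors m k)) ⟩
  #light m (suc k) + #light m k ∎
  where open ≡-Reasoning

#light≤2^ : ∀ m k → #light m k ≤ 2 ^ m
#light≤2^ zero k = ≤-refl
#light≤2^ (suc m) zero = begin
  #light (suc m) zero ≡⟨ #light-zero m ⟩
  #light m zero       ≤⟨ #light≤2^ m zero ⟩
  2 ^ m               ≤⟨ m≤m+n (2 ^ m) _ ⟩
  2 ^ suc m           ∎
  where open ≤-Reasoning
#light≤2^ (suc m) (suc k) = begin
  #light (suc m) (suc k)          ≡⟨ #light-suc m k ⟩
  #light m (suc k) + #light m k   ≤⟨ +-mono-≤ (#light≤2^ m (suc k)) (#light≤2^ m k) ⟩
  2 ^ m + 2 ^ m                   ≡⟨ cong (2 ^ m +_) (sym (+-identityʳ (2 ^ m))) ⟩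
  2 ^ suc m                       ∎
  where open ≤-Reasoning

#light≤poly : ∀ m k → #light m k ≤ suc m ^ k
#light≤poly zero k = ≤-reflexive (sym (^-zeroˡ k))
#light≤poly (suc m) zero = ≤-trans (≤-reflexive (#light-zero m)) (#light≤poly m zero)
#light≤poly (suc m) (suc k) = begin
  #light (suc m) (suc k)          ≡⟨ #light-suc m k ⟩
  #light m (suc k) + #light m k   ≤⟨ +-mono-≤ (#light≤poly m (suc k)) (#light≤poly m k) ⟩
  suc m ^ suc k + suc m ^ k       ≡⟨ +-comm (suc m ^ suc k) (suc m ^ k) ⟩
  suc (suc m) * suc m ^ k         ≤⟨ *-monoʳ-≤ (suc (suc m)) (^-monoˡ-≤ k (n≤1+n (suc m))) ⟩
  suc (suc m) ^ suc k             ∎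
  where open ≤-Reasoning

#light-mono : ∀ {m m′} k → m ≤ m′ → #light m k ≤ #light m′ k
#light-mono k m≤m′ = go (≤⇒≤′ m≤m′)
  where
    step : ∀ m k → #light m k ≤ #light (suc m) k
    step m zero = ≤-reflexive (sym (#light-zero m))
    step m (suc k) = ≤-trans (m≤m+n _ _) (≤-reflexive (sym (#light-suc m k)))
    go : ∀ {m m′} → m ≤′ m′ → #light m k ≤ #light m′ k
    go ≤′-refl = ≤-refl
    go (≤′-step h) = ≤-trans (go h) (step _ k)

weight-∨ : {A : Set} (a b : A → Bool) (xs : List A)
         → weight (map (λ x → a x ∨ b x) xs) ≤ weight (map a xs) + weight (map b xs)
weight-∨ a b [] = z≤n
weight-∨ a b (x ∷ xs) with a x | b x
... | true  | true  = s≤s (≤-trans (weight-∨ a b xs) (+-monoʳ-≤ (weight (map a xs)) (n≤1+n _)))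
... | true  | false = s≤s (weight-∨ a b xs)
... | false | true  = ≤-trans (s≤s (weight-∨ a b xs)) (≤-reflexive (sym (+-suc _ _)))
... | false | false = weight-∨ a b xs

weight-indicator : {A : Set} {P : Pred A 0ℓ} (P? : Decidable P) (xs : List A)
                 → weight (map (does ∘ P?) xs) ≡ length (filter P? xs)
weight-indicator P? [] = refl
weight-indicator P? (x ∷ xs) with P? x
... | yes _ = cong suc (weight-indicator P? xs)
... | no _ = weight-indicator P? xs

map-pointwise : {A B : Set} {f g : A → B} {x : A} (xs : List A)
              → map f xs ≡ map g xs → x ∈ xs → f x ≡ g x
map-pointwise (_ ∷ _) e (here refl) = proj₁ (∷-injective e)
map-pointwise (_ ∷ xs) e (there x∈xs) = map-pointwise xs (proj₂ (∷-injective e)) x∈xs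

^-distribʳ-* : ∀ a b k → (a * b) ^ k ≡ a ^ k * b ^ k
^-distribʳ-* a b zero = refl
^-distribʳ-* a b (suc k) = trans (cong (a * b *_) (^-distribʳ-* a b k)) (interchange a b (a ^ k) (b ^ k))
  where interchange : ∀ a b p q → a * b * (p * q) ≡ a * p * (b * q)
        interchange = solve-∀

-- If |P_i| ≤ s then |P_{i+1}| ≤ growth s: the old
-- s elements plus, for each light vector (code) of length s and each of the two
-- kinds (new minimal / new maximal), an antichain of at most w elements.

module Growth (w : ℕ) where

  codes : ℕ → ℕ
  codes s = #light s (w + w)

  growth : ℕ → ℕ
  growth s = s + (codes s * w + codes s * w)

  codes-double : ∀ {x} → 1 ≤ x → codes (2 * x) ≤ 3 ^ (w + w) * x ^ (w + w)
  codes-double {x} 1≤x = begin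
    codes (2 * x)          ≤⟨ #light≤poly (2 * x) (w + w) ⟩
    suc (2 * x) ^ (w + w)  ≤⟨ ^-monoˡ-≤ (w + w) (+-monoˡ-≤ (2 * x) 1≤x) ⟩
    (3 * x) ^ (w + w)      ≡⟨ ^-distribʳ-* 3 x (w + w) ⟩
    3 ^ (w + w) * x ^ (w + w) ∎
    where open ≤-Reasoning

  growth-double : ∀ {x y} → x + codes (2 * x) * w ≤ y → growth (2 * x) ≤ 2 * y
  growth-double {x} {y} h = begin
    2 * x + (c + c)   ≡⟨ regroup x c ⟩
    2 * (x + c)       ≤⟨ *-monoʳ-≤ 2 h ⟩
    2 * y             ∎
    where
      open ≤-Reasoning
      c = codes (2 * x) * w
      regroup : ∀ x c → 2 * x + (c + c) ≡ 2 * (x + c)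
      regroup = solve-∀

  -- From here on w ≥ 2; the two estimates below are the cases k = 0 and k ≥ 1.
  module _ (w≥2 : 2 ≤ w) where

    private
      1≤w : 1 ≤ w
      1≤w = ≤-trans (s≤s z≤n) w≥2
      instance
        w-nonZero : NonZero w
        w-nonZero = >-nonZero 1≤w

    w+w≤w^w : w + w ≤ w ^ w
    w+w≤w^w = begin
      w + w       ≡⟨ cong (w +_) (sym (+-identityʳ w)) ⟩
      2 * w       ≤⟨ *-monoˡ-≤ w w≥2 ⟩
      w * w       ≡⟨ cong (w *_) (sym (*-identityʳ w)) ⟩
      w ^ 2       ≤⟨ ^-monoʳ-≤ w w≥2 ⟩
      w ^ w       ∎
      where open ≤-Reasoning

    -- k = 0: |P_0| ≤ 2w, and there are at most 2^(2w) codes.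
    growth-first : w + codes (2 * w) * w ≤ w ^ (3 * w)
    growth-first = begin
      w + codes (2 * w) * w  ≤⟨ +-mono-≤ (m≤n*m w t ⦃ m^n≢0 2 (2 * w) ⦄) (*-monoˡ-≤ w (#light≤2^ (2 * w) (w + w))) ⟩
      t * w + t * w          ≡⟨ sym (*-distribˡ-+ t w w) ⟩
      t * (w + w)            ≤⟨ *-mono-≤ (^-monoˡ-≤ (2 * w) w≥2) w+w≤w^w ⟩
      w ^ (2 * w) * w ^ w    ≡⟨ sym (^-distribˡ-+-* w (2 * w) w) ⟩
      w ^ (2 * w + w)        ≡⟨ cong (w ^_) (exponent w) ⟩
      w ^ (3 * w)            ∎
      where
        open ≤-Reasoning
        t = 2 ^ (2 * w)
        exponent : ∀ w → 2 * w + w ≡ 3 * w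
        exponent = solve-∀

    -- 1 + 9^w·w ≤ w^(3w·w), the factor by which the codes outnumber x^(2w) below.
    few-codes-factor : suc (3 ^ (w + w) * w) ≤ w ^ (3 * w * w)
    few-codes-factor = begin
      suc z                                  ≤⟨ +-monoˡ-≤ z (*-mono-≤ (m^n>0 3 (w + w)) 1≤w) ⟩
      z + z                                  ≡⟨ sym (*-distribˡ-+ (3 ^ (w + w)) w w) ⟩
      3 ^ (w + w) * (w + w)                  ≤⟨ *-mono-≤ (^-monoˡ-≤ (w + w) 3≤w*w) w+w≤w^w ⟩
      (w * w) ^ (w + w) * w ^ w              ≡⟨ cong (_* w ^ w) (^-distribʳ-* w w (w + w)) ⟩
      w ^ (w + w) * w ^ (w + w) * w ^ w      ≡⟨ cong (_* w ^ w) (sym (^-distribˡ-+-* w (w + w) (w + w))) ⟩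
      w ^ ((w + w) + (w + w)) * w ^ w        ≡⟨ sym (^-distribˡ-+-* w ((w + w) + (w + w)) w) ⟩
      w ^ (((w + w) + (w + w)) + w)          ≤⟨ ^-monoʳ-≤ w exponent ⟩
      w ^ (3 * w * w)                        ∎
      where
        open ≤-Reasoning
        z = 3 ^ (w + w) * w
        3≤w*w : 3 ≤ w * w
        3≤w*w = ≤-trans (n≤1+n 3) (*-mono-≤ w≥2 w≥2)
        five : ∀ w → ((w + w) + (w + w)) + w + w ≡ 3 * w * 2
        five = solve-∀
        exponent : ((w + w) + (w + w)) + w ≤ 3 * w * w
        exponent = ≤-trans (m≤m+n _ w) (≤-trans (≤-reflexive (five w)) (*-monoʳ-≤ (3 * w) w≥2))

    -- k ≥ 1: |P_k| ≤ 2x with x ≥ w^(3w), and there are at most (2x+1)^(2w) codes.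
    growth-later : ∀ {x} → w ^ (3 * w) ≤ x → x + codes (2 * x) * w ≤ x ^ (3 * w)
    growth-later {x} big = begin
      x + codes (2 * x) * w      ≤⟨ +-mono-≤ x≤e (*-monoˡ-≤ w (codes-double 1≤x)) ⟩
      e + 3 ^ (w + w) * e * w    ≡⟨ cong (e +_) (reorder (3 ^ (w + w)) e w) ⟩
      suc z * e                  ≤⟨ *-monoˡ-≤ e 1+z≤x^w ⟩
      x ^ w * e                  ≡⟨ sym (^-distribˡ-+-* x w (w + w)) ⟩
      x ^ (w + (w + w))          ≡⟨ cong (x ^_) (triple w) ⟩
      x ^ (3 * w)                ∎
      where
        open ≤-Reasoning
        e = x ^ (w + w)
        z = 3 ^ (w + w) * w
        reorder : ∀ a e w → a * e * w ≡ a * w * e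
        reorder = solve-∀
        triple : ∀ w → w + (w + w) ≡ 3 * w
        triple = solve-∀
        1≤x : 1 ≤ x
        1≤x = ≤-trans (m^n>0 w (3 * w)) big
        x≤e : x ≤ e
        x≤e = ≤-trans (≤-reflexive (sym (^-identityʳ x)))
                      (^-monoʳ-≤ x ⦃ >-nonZero 1≤x ⦄ (≤-trans 1≤w (m≤m+n w w)))
        1+z≤x^w : suc z ≤ x ^ w
        1+z≤x^w = begin
          suc z              ≤⟨ few-codes-factor ⟩
          w ^ (3 * w * w)    ≡⟨ sym (^-*-assoc w (3 * w) w) ⟩
          (w ^ (3 * w)) ^ w  ≤⟨ ^-monoˡ-≤ w big ⟩
          x ^ w              ∎

module Extremal {n : ℕ} (_⊑_ : Fin n → Fin n → Set) (isPO : IsPartialOrder _≡_ _⊑_) where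
  open Construction _⊑_ using (Min)
  open IsPartialOrder isPO using () renaming (refl to ⊑-refl; trans to ⊑-trans)

  minimal-below : (S : Fin n → Set) {t : Fin n} → S t → ¬ ¬ (∃ λ m → Min S m × m ⊑ t)
  minimal-below S = descend _ (po-wellFounded isPO _)
    where
      descend : ∀ t → Acc _ t → S t → ¬ ¬ (∃ λ m → Min S m × m ⊑ t)
      descend t (acc smaller) st = ¬¬-excluded-middle {A = ∃ λ z → S z × z ⊑ t × ¬ z ≡ t} >>= λ where
        (yes (z , sz , z⊑t , z≢t)) → do
          (m , min-m , m⊑z) ← descend z (smaller (z⊑t , z≢t)) sz
          pure (m , min-m , ⊑-trans m⊑z z⊑t)
        (no nothing-below) →
          pure (t , (st , λ z sz z⊑t → decidable-stable (z ≟ᶠ t) (λ z≢t → nothing-below (z , sz , z⊑t , z≢t)))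
               , ⊑-refl)

module Poset {n : ℕ} (_⊑_ : Fin n → Fin n → Set) (isPO : IsPartialOrder _≡_ _⊑_) where
  open Construction _⊑_ using (Min; Max; Incomparable; IsAntichain; Whole; L₀; Lₖ; Uₖ; Pₖ)
  open IsPartialOrder isPO using (antisym) renaming (reflexive to ≡⇒⊑; trans to ⊑-trans)

  maximal-above : (S : Fin n → Set) {t : Fin n} → S t → ¬ ¬ (∃ λ m → Max S m × t ⊑ m)
  maximal-above = Extremal.minimal-below (flip _⊑_) (Flip.isPartialOrder isPO)

  -- The profile of y relative to (L , U): the elements of L below y and the
  -- elements of U above y.  The cells P_{i,R} are unions of profile classes.
  module Profiles (L U : Fin n → Set) where
    open Construction.Step _⊑_ L U using (Cell)

    SameProfile : Fin n → Fin n → Set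
    SameProfile y y′ = (∀ l → L l → (l ⊑ y → l ⊑ y′) × (l ⊑ y′ → l ⊑ y))
                     × (∀ u → U u → (y ⊑ u → y′ ⊑ u) × (y′ ⊑ u → y ⊑ u))

    sameProfile-sym : ∀ {y y′} → SameProfile y y′ → SameProfile y′ y
    sameProfile-sym (lower , upper) = (λ l ll → swap (lower l ll)) , (λ u uu → swap (upper u uu))

    cell-respects : ∀ {R y y′} → SameProfile y y′ → Cell R y → Cell R y′
    cell-respects (lower , upper) (cellL , cellU) =
      (λ l ll → rewire (cellL l ll) (lower l ll)) , (λ u uu → rewire (cellU u uu) (upper u uu))
      where
        rewire : {A B C : Set} → (A → C) × (C → A) → (A → B) × (B → A) → (B → C) × (C → B)
        rewire (a→c , c→a) (a→b , b→a) = a→c ∘ b→a , a→b ∘ c→a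

  -- In a chain, every element of L_k is least and every element of U_k greatest,
  -- so |P_k| ≤ 2.
  module Chain (comparable : ∀ x y → x ⊑ y ⊎ y ⊑ x) where

    min-least : ∀ {S x} → (∀ y → S y) → Min S x → ∀ y → x ⊑ y
    min-least {x = x} everything (_ , minimal) y with comparable x y
    ... | inj₁ x⊑y = x⊑y
    ... | inj₂ y⊑x = ≡⇒⊑ (sym (minimal y (everything y) y⊑x))

    max-greatest : ∀ {S x} → (∀ y → S y) → Max S x → ∀ y → y ⊑ x
    max-greatest {x = x} everything (_ , maximal) y with comparable x y
    ... | inj₁ x⊑y = ≡⇒⊑ (maximal y (everything y) x⊑y)
    ... | inj₂ y⊑x = y⊑x

    -- Mutual induction on k: new elements are extremal in a cell, which is everything.
    L-least : ∀ k {x} → Lₖ k x → ∀ y → x ⊑ y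
    U-greatest : ∀ k {x} → Uₖ k x → ∀ y → y ⊑ x

    -- Hence all elements share one profile, and each cell is everything.
    uniform : ∀ k y y′ → Profiles.SameProfile (Lₖ k) (Uₖ k) y y′
    uniform k y y′ = (λ l ll → (λ _ → L-least k ll y′) , (λ _ → L-least k ll y))
                   , (λ u uu → (λ _ → U-greatest k uu y′) , (λ _ → U-greatest k uu y))

    L-least zero lx = min-least (λ _ → tt) lx
    L-least (suc k) (inj₁ lx) = L-least k lx
    L-least (suc k) (inj₂ (_ , _ , mx)) =
      min-least (λ y → Profiles.cell-respects (Lₖ k) (Uₖ k) (uniform k _ y) (proj₁ mx)) mx
    U-greatest zero ux = max-greatest (λ _ → tt) (proj₁ ux)
    U-greatest (suc k) (inj₁ ux , _) = U-greatest k ux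
    U-greatest (suc k) (inj₂ (_ , _ , mx) , _) =
      max-greatest (λ y → Profiles.cell-respects (Lₖ k) (Uₖ k) (uniform k _ y) (proj₁ mx)) mx

    -- L_k and U_k each have at most one element, so three distinct elements of P_k
    -- cannot exist.
    chain-bound : ∀ k → AtMost (Pₖ k) 2
    chain-bound k [] _ _ = z≤n
    chain-bound k (_ ∷ []) _ _ = s≤s z≤n
    chain-bound k (_ ∷ _ ∷ []) _ _ = s≤s (s≤s z≤n)
    chain-bound k (a ∷ b ∷ c ∷ _) ((a≢b ∷ a≢c ∷ _) ∷ (b≢c ∷ _) ∷ _) (pa ∷ pb ∷ pc ∷ _) = ⊥-elim (pigeonhole pa pb pc)
      where
        L-unique : ∀ {x y} → Lₖ k x → Lₖ k y → x ≡ y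
        L-unique lx ly = antisym (L-least k lx _) (L-least k ly _)
        U-unique : ∀ {x y} → Uₖ k x → Uₖ k y → x ≡ y
        U-unique ux uy = antisym (U-greatest k uy _) (U-greatest k ux _)
        pigeonhole : Pₖ k a → Pₖ k b → Pₖ k c → ⊥
        pigeonhole (inj₁ la) (inj₁ lb) _ = a≢b (L-unique la lb)
        pigeonhole (inj₂ ua) (inj₂ ub) _ = a≢b (U-unique ua ub)
        pigeonhole (inj₁ la) (inj₂ _) (inj₁ lc) = a≢c (L-unique la lc)
        pigeonhole (inj₁ _) (inj₂ ub) (inj₂ uc) = b≢c (U-unique ub uc)
        pigeonhole (inj₂ _) (inj₁ lb) (inj₁ lc) = b≢c (L-unique lb lc)
        pigeonhole (inj₂ ua) (inj₁ _) (inj₂ uc) = a≢c (U-unique ua uc)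

  module Width (w : ℕ) (width : ∀ xs → IsAntichain xs → length xs ≤ w) where
    open Growth w

    atMost-antichain : {S : Fin n → Set} → (∀ {x y} → S x → S y → x ⊑ y → x ≡ y) → AtMost S w
    atMost-antichain {S} collapse xs u s = width xs (u , incomparable xs u s)
      where
        incomparable : ∀ xs → Unique xs → All S xs → AllPairs Incomparable xs
        incomparable [] [] [] = []
        incomparable (x ∷ xs) (x∉xs ∷ u) (sx ∷ s) =
          All.zipWith (λ (x≢y , sy) → (λ x⊑y → x≢y (collapse sx sy x⊑y))
                                     , (λ y⊑x → x≢y (sym (collapse sy sx y⊑x))))
                      (x∉xs , s)
          ∷ incomparable xs u s

    min-antichain : (S : Fin n → Set) → AtMost (Min S) w
    min-antichain S = atMost-antichain (λ mx my x⊑y → proj₂ my _ (proj₁ mx) x⊑y)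

    max-antichain : (S : Fin n → Set) → AtMost (Max S) w
    max-antichain S = atMost-antichain (λ mx my x⊑y → sym (proj₂ mx _ (proj₁ my) x⊑y))

    chain-of-width-one : (∀ x y → Dec (x ⊑ y)) → w ≤ 1 → ∀ x y → x ⊑ y ⊎ y ⊑ x
    chain-of-width-one _⊑?_ w≤1 x y with x ⊑? y | y ⊑? x | x ≟ᶠ y
    ... | yes x⊑y | _ | _ = inj₁ x⊑y
    ... | no _ | yes y⊑x | _ = inj₂ y⊑x
    ... | no _ | no _ | yes x≡y = inj₁ (≡⇒⊑ x≡y)
    ... | no x⋢y | no y⋢x | no x≢y with ≤-trans (width (x ∷ y ∷ []) (((x≢y ∷ []) ∷ [] ∷ []) , (((x⋢y , y⋢x) ∷ []) ∷ [] ∷ []))) w≤1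
    ...   | s≤s ()

    base-bound : AtMost (Pₖ 0) (w + w)
    base-bound = atMost-stable do
      L₀? ← ¬¬-decidable L₀
      pure (atMost-∪ L₀? (min-antichain Whole) (atMost-⊆ proj₁ (max-antichain Whole)))

    module OneStep (_⊑?_ : ∀ x y → Dec (x ⊑ y)) (L U : Fin n → Set) (disjoint : ∀ {x} → U x → ¬ L x) where
      open Construction.Step _⊑_ L U using (Admissible; Cell; L'; U')
      open Profiles L U

      NewMin NewMax : Fin n → Set
      NewMin y = Σ (Fin n → Bool) λ R → Admissible R × Min (Cell R) y
      NewMax y = Σ (Fin n → Bool) λ R → Admissible R × Max (Cell R) y

      -- Comparable new minimal (maximal) elements with equal profiles coincide,
      -- because each lies in the other's cell.
      newMin-collapse : ∀ {y y′} → NewMin y → NewMin y′ → SameProfile y y′ → y ⊑ y′ → y ≡ y′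
      newMin-collapse _ (_ , _ , cell′ , minimal′) same y⊑y′ =
        minimal′ _ (cell-respects (sameProfile-sym same) cell′) y⊑y′

      newMax-collapse : ∀ {y y′} → NewMax y → NewMax y′ → SameProfile y y′ → y ⊑ y′ → y ≡ y′
      newMax-collapse (_ , _ , cell , maximal) _ same y⊑y′ = sym (maximal _ (cell-respects same cell) y⊑y′)

      Below Above : Fin n → Fin n → Set
      Below y l = L l × l ⊑ y
      Above y u = U u × y ⊑ u

      module Code (maxBelow? : ∀ y m → Dec (Max (Below y) m)) (minAbove? : ∀ y m → Dec (Min (Above y) m))
                  (ps : List (Fin n)) (ps-unique : Unique ps) (ps-complete : ∀ {x} → (L ∪ U) x → x ∈ ps) where

        marked : Fin n → Fin n → Bool
        marked y m = does (maxBelow? y m) ∨ does (minAbove? y m)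

        code : Fin n → List Bool
        code y = map (marked y) ps

        max-marked : ∀ {y m} → Max (Below y) m → T (marked y m)
        max-marked {y} {m} mx with maxBelow? y m
        ... | yes _ = tt
        ... | no ¬mx = ⊥-elim (¬mx mx)

        min-marked : ∀ {y m} → Min (Above y) m → T (marked y m)
        min-marked {y} {m} mn with maxBelow? y m | minAbove? y m
        ... | yes _ | _ = tt
        ... | no _ | yes _ = tt
        ... | no _ | no ¬mn = ⊥-elim (¬mn mn)

        -- As L and U are disjoint, a mark on m ∈ L (m ∈ U) means maximal (minimal).
        marked-max : ∀ {y m} → L m → T (marked y m) → Max (Below y) m
        marked-max {y} {m} lm t with maxBelow? y m | minAbove? y m
        ... | yes mx | _ = mx
        ... | no _ | yes mn = ⊥-elim (disjoint (proj₁ (proj₁ mn)) lm)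
        marked-max lm () | no _ | no _

        marked-min : ∀ {y m} → U m → T (marked y m) → Min (Above y) m
        marked-min {y} {m} um t with maxBelow? y m | minAbove? y m
        ... | yes mx | _ = ⊥-elim (disjoint um (proj₁ (proj₁ mx)))
        ... | no _ | yes mn = mn
        marked-min um () | no _ | no _

        transfer : ∀ {y y′ m} → code y ≡ code y′ → (L ∪ U) m → T (marked y m) → T (marked y′ m)
        transfer e pm = subst T (map-pointwise _ e (ps-complete pm))

        -- Every l ∈ L below y lies below a marked element, hence below y′; dually
        -- every u ∈ U above y lies above a marked element, hence above y′.
        lower-transfer : ∀ {y y′ l} → code y ≡ code y′ → L l → l ⊑ y → l ⊑ y′
        lower-transfer e ll l⊑y = decidable-stable (_ ⊑? _) do
          (m , max-m , l⊑m) ← maximal-above (Below _) (ll , l⊑y)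
          let lm = proj₁ (proj₁ max-m)
          pure (⊑-trans l⊑m (proj₂ (proj₁ (marked-max lm (transfer e (inj₁ lm) (max-marked max-m))))))

        upper-transfer : ∀ {y y′ u} → code y ≡ code y′ → U u → y ⊑ u → y′ ⊑ u
        upper-transfer e uu y⊑u = decidable-stable (_ ⊑? _) do
          (m , min-m , m⊑u) ← Extremal.minimal-below _⊑_ isPO (Above _) (uu , y⊑u)
          let um = proj₁ (proj₁ min-m)
          pure (⊑-trans (proj₂ (proj₁ (marked-min um (transfer e (inj₂ um) (min-marked min-m))))) m⊑u)

        same-code⇒same-profile : ∀ {y y′} → code y ≡ code y′ → SameProfile y y′
        same-code⇒same-profile e = (λ l ll → lower-transfer e ll , lower-transfer (sym e) ll)
                                 , (λ u uu → upper-transfer e uu , upper-transfer (sym e) uu)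

        -- The marked elements form two antichains, so a code has weight ≤ 2w.
        weight-code : ∀ y → weight (code y) ≤ w + w
        weight-code y = ≤-trans (weight-∨ _ _ ps)
                          (+-mono-≤ (hits (maxBelow? y) (max-antichain _)) (hits (minAbove? y) (min-antichain _)))
          where
            hits : {S : Fin n → Set} (S? : Decidable S) → AtMost S w → weight (map (does ∘ S?) ps) ≤ w
            hits S? bound = ≤-trans (≤-reflexive (weight-indicator S? ps))
                                    (bound _ (Unique.filter⁺ S? ps-unique) (All.all-filter S? ps))

        codes-ps : List (List Bool)
        codes-ps = lightVectors (length ps) (w + w)

        code∈codes : ∀ y → code y ∈ codes-ps
        code∈codes y = subst (λ m → code y ∈ lightVectors m (w + w)) (length-map _ ps)
                             (lightVectors-complete (code y) (w + w) (weight-code y))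

        -- Each code class of new extremal elements is an antichain.
        new-min-bound : AtMost NewMin (length codes-ps * w)
        new-min-bound = atMost-fibres (≡-dec Bool._≟_) code codes-ps (λ {y} _ → code∈codes y)
          (λ c → atMost-antichain (λ (nm , e) (nm′ , e′) →
                   newMin-collapse nm nm′ (same-code⇒same-profile (trans e (sym e′)))))

        new-max-bound : AtMost NewMax (length codes-ps * w)
        new-max-bound = atMost-fibres (≡-dec Bool._≟_) code codes-ps (λ {y} _ → code∈codes y)
          (λ c → atMost-antichain (λ (nm , e) (nm′ , e′) →
                   newMax-collapse nm nm′ (same-code⇒same-profile (trans e (sym e′)))))

      new-or-old : (L' ∪ U') ⊆ (L ∪ U) ∪ (NewMin ∪ NewMax)
      new-or-old (inj₁ (inj₁ lx)) = inj₁ (inj₁ lx)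
      new-or-old (inj₁ (inj₂ nm)) = inj₂ (inj₁ nm)
      new-or-old (inj₂ (inj₁ ux , _)) = inj₁ (inj₂ ux)
      new-or-old (inj₂ (inj₂ nx , _)) = inj₂ (inj₂ nx)

      -- |P_{i+1}| ≤ growth |P_i|.  Classically all the relevant sets are decidable,
      -- so the elements ps of P_i can be listed and codes formed.
      step-bound : ∀ {s} → AtMost (L ∪ U) s → AtMost (L' ∪ U') (growth s)
      step-bound {s} bound = atMost-stable do
        P? ← ¬¬-decidable (L ∪ U)
        NewMin? ← ¬¬-decidable NewMin
        maxBelow? ← ¬¬-decidable₂ (λ y → Max (Below y))
        minAbove? ← ¬¬-decidable₂ (λ y → Min (Above y))
        let ps = filter P? (allFin n)
            ps-unique = Unique.filter⁺ P? (Unique.allFin⁺ n)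
            |ps|≤s = bound ps ps-unique (All.all-filter P? (allFin n))
            fewer = *-monoˡ-≤ w (#light-mono (w + w) |ps|≤s)
            open Code maxBelow? minAbove? ps ps-unique (λ px → ∈-filter⁺ P? (∈-allFin _) px)
        pure (atMost-⊆ new-or-old (atMost-weaken (+-monoʳ-≤ s (+-mono-≤ fewer fewer))
               (atMost-∪ P? bound (atMost-∪ NewMin? new-min-bound new-max-bound))))

    module LargeWidth (w≥2 : 2 ≤ w) (_⊑?_ : ∀ x y → Dec (x ⊑ y)) where
      private instance
        w-nonZero : NonZero w
        w-nonZero = >-nonZero (≤-trans (s≤s z≤n) w≥2)
        3w-nonZero : NonZero (3 * w)
        3w-nonZero = m*n≢0 3 w

      X : ℕ → ℕ
      X k = w ^ ((3 * w) ^ k)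

      X-suc : ∀ k → X (suc k) ≡ X k ^ (3 * w)
      X-suc k = trans (cong (w ^_) (*-comm (3 * w) ((3 * w) ^ k))) (sym (^-*-assoc w ((3 * w) ^ k) (3 * w)))

      X-large : ∀ k → w ^ (3 * w) ≤ X (suc k)
      X-large k = ^-monoʳ-≤ w (m≤m*n (3 * w) ((3 * w) ^ k) ⦃ m^n≢0 (3 * w) k ⦄)

      half-growth : ∀ k → X k + codes (2 * X k) * w ≤ X k ^ (3 * w)
      half-growth zero = subst (λ x → x + codes (2 * x) * w ≤ x ^ (3 * w)) (sym (^-identityʳ w)) (growth-first w≥2)
      half-growth (suc k) = growth-later w≥2 (X-large k)

      disjoint : ∀ k {x} → Uₖ k x → ¬ Lₖ k x
      disjoint zero = proj₂
      disjoint (suc k) = proj₂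

      size-bound : ∀ k → AtMost (Pₖ k) (2 * X k)
      size-bound zero = atMost-weaken (≤-reflexive (double w)) base-bound
        where double : ∀ w → w + w ≡ 2 * (w * 1)
              double = solve-∀
      size-bound (suc k) = atMost-weaken (growth-double {X k} (≤-trans (half-growth k) (≤-reflexive (sym (X-suc k)))))
                             (OneStep.step-bound _⊑?_ (Lₖ k) (Uₖ k) (disjoint k) (size-bound k))

lemma3 : (n : ℕ) → 2 ≤ n → (_⊑_ : Fin n → Fin n → Set) → IsPartialOrder _≡_ _⊑_
       → (w : ℕ) → Construction.IsWidth _⊑_ w → (k : ℕ)
       → Construction.CardLE _⊑_ (Construction.Pₖ _⊑_ k) (2 * w ^ ((3 * w) ^ k))
-- Width 0 is impossible (a singleton is an antichain); width 1 is the chain case;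
-- width ≥ 2 is the main induction.  The order is classically decidable.
lemma3 (suc _) _ _⊑_ isPO zero (_ , width) k with width (zero ∷ []) ([] ∷ [] , [] ∷ [])
... | ()
lemma3 n _ _⊑_ isPO (suc zero) (_ , width) k = atMost-stable do
  _⊑?_ ← ¬¬-decidable₂ _⊑_
  let chain = Width.chain-of-width-one 1 width _⊑?_ ≤-refl
  pure (atMost-weaken (≤-reflexive (cong (2 *_) (sym (^-zeroˡ ((3 * 1) ^ k))))) (Chain.chain-bound chain k))
  where open Poset _⊑_ isPO
lemma3 n _ _⊑_ isPO w@(suc (suc _)) (_ , width) k = atMost-stable do
  _⊑?_ ← ¬¬-decidable₂ _⊑_
  pure (LargeWidth.size-bound (s≤s (s≤s z≤n)) _⊑?_ k)
  where open Poset _⊑_ isPO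
        open Width w width
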